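{- Let $n=2^s\cdot m$ with $s\geq2$ and $m\geq1$ odd, and let $f=\gamma_0+\sum_{i=1}^ta_i\gamma_{2i}$ with $a_i\in\mathbb{F}_2$. Then $f$ is a permutation of $\mathbb{F}_2^n$ if and only if $f$ is a permutation of $\mathbb{F}_2^{2m}$.
   Context: For $N\geq1$ let $\mathbbm{1}=(1,\dots,1)\in\mathbb{F}_2^N$, let $\odot$ denote component-wise multiplication in $\mathbb{F}_2^N$, and let $S(x_1,\dots,x_N)=(x_2,\dots,x_N,x_1)$. Define $\gamma_0=\mathrm{id}$ and, for $k\geq1$, $\gamma_{2k}(x)=S^{2k}(x)\odot(\mathbbm{1}+S^{2k-1}(x))\odot(\mathbbm{1}+S^{2k-3}(x))\odot\cdots\odot(\mathbbm{1}+S(x))$ on $\mathbb{F}_2^N$; sums are pointwise. The same formal combination $f$ thus defines a function on $\mathbb{F}_2^N$ for every $N$. -}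

module Defs where

open import Data.Nat using (ℕ; zero; suc; _+_; _*_; _^_; NonZero)
open import Data.Nat.DivMod using (_%_; m%n<n)
open import Data.Nat.Properties using ()
open import Data.Fin using (Fin; toℕ; fromℕ<)
open import Data.Bool using (Bool; true; false; _xor_; _∧_; not)
open import Data.Vec using (Vec; lookup; tabulate)
open import Function.Definitions using (Bijective)
open import Relation.Binary.PropositionalEquality using (_≡_)

-- Elements of F_2^N are Vec Bool N; addition is xor, multiplication is ∧.

-- Coordinate j (0-based) of S^k(x): S(x)_j = x_{j+1 mod N}, so S^k(x)_j = x_{(j+k) mod N}.
shiftAt : ∀ {N} → Vec Bool N → ℕ → Fin N → Bool
shiftAt {suc N} x k j = lookup x (fromℕ< (m%n<n (toℕ j + k) (suc N)))

-- coordinate j of  (1 + S^{2k-1}x) ⊙ (1 + S^{2k-3}x) ⊙ ... ⊙ (1 + S^1 x)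
-- oddProd x k j = ∏_{l=1}^{k} (1 + x_{(j + 2l - 1) mod N})
oddProd : ∀ {N} → Vec Bool N → ℕ → Fin N → Bool
oddProd x zero j = true
oddProd x (suc k) j = not (shiftAt x (k + k + 1) j) ∧ oddProd x k j

-- γ_{2k} for k ≥ 1 (and γ_0 = id, consistent with k = 0)
γ : ∀ {N} → ℕ → Vec Bool N → Vec Bool N
γ k x = tabulate λ j → shiftAt x (k + k) j ∧ oddProd x k j

-- Σ_{i=1}^{t} a_i γ_{2i}(x), coordinate j, with a : Vec Bool t, a_i = lookup a (i-1)
sumγ : ∀ {N} → (t : ℕ) → Vec Bool t → Vec Bool N → Fin N → Bool
sumγ zero a x j = false
sumγ (suc t) a x j =
  sumγ t (Data.Vec.init a) x j xor (Data.Vec.last a ∧ lookup (γ (suc t) x) j)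

fMap : ∀ {N} → (t : ℕ) → Vec Bool t → Vec Bool N → Vec Bool N
fMap t a x = tabulate λ j → lookup x j xor sumγ t a x j

IsPermutation : ∀ {N} → (Vec Bool N → Vec Bool N) → Set
IsPermutation {N} g = Bijective {A = Vec Bool N} _≡_ _≡_ g

{-# OPTIONS --safe #-}
-- Write P = 1 + Σ aᵢ Xⁱ and read x ∈ F₂^(2M) as a 2M-periodic sequence. Then
-- f(x)ⱼ = Σₖ Pₖ x(j+2k) ∏_{l<k} (1 + x(j+2l+1)): the entries of one parity class are data,
-- gated by the entries of the other class. If some gate within a period is true, an explicit
-- Horner expression in f(x) recovers x locally; if all gates of a class are false, f acts on
-- the data of the other class as the circulant map s ↦ Σₖ Pₖ s(i+k) on M-periodic sequences.
-- Hence f permutes F₂^(2M) iff this linear map is injective. For 2M-periodic s in its kernel,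
-- s + s(· + M) is M-periodic and in the kernel too, so the answer is the same for M and 2M;
-- as 2^s m = 2 · 2^(s-1) m, the cases n = 2^s m and n = 2m agree.
module Submission where

open import Defs
open import Data.Nat.Divisibility using (_∤_)
open import Function.Bundles using (_⇔_; _↔_; Inverse; Injection; mk⇔)

open import Algebra.Bundles using (CommutativeMonoid; CommutativeRing)
import Algebra.Properties.CommutativeSemigroup as CommutativeSemigroupProperties
open import Data.Bool using (Bool; true; false; not; _∧_; _xor_)
open import Data.Bool.Properties
  using (∧-zeroʳ; ∧-identityʳ; ∧-distribˡ-xor; ∧-distribʳ-xor; ∧-commutativeMonoid;
         xor-identityʳ; xor-assoc; xor-comm; xor-same; xor-∧-commutativeRing)
open import Data.Empty using (⊥; ⊥-elim)
open import Data.Fin using (Fin; toℕ; fromℕ<; punchOut)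
open import Data.Fin.Properties
  using (toℕ-injective; toℕ-fromℕ<; fromℕ<-cong; toℕ<n; any?; _≟_; punchOut-injective; injective⇒≤;
         2↔Bool)
open import Data.List using (List; []; _∷_; _++_; [_]; length)
open import Data.Nat using (ℕ; zero; suc; _+_; _*_; _^_; _<_; _≤_; s≤s; NonZero; >-nonZero)
open import Data.Nat.DivMod using (_%_; _/_; m≡m%n+[m/n]*n; m%n<n; [m+n]%n≡m%n; m<n⇒m%n≡m)
open import Data.Nat.Properties using (+-identityʳ; +-assoc; *-assoc; *-suc; *-identityˡ; n≮n; m*n≢0; m^n≢0)
open import Data.Nat.Tactic.RingSolver using (solve)
open import Data.Product using (∃-syntax; _×_; _,_; proj₁; proj₂)
open import Data.Sum using (_⊎_; inj₁; inj₂)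
open import Data.Vec using (Vec; []; lookup; tabulate; toList; init; last; initLast)
open import Data.Vec.Properties using (lookup∘tabulate; tabulate∘lookup; tabulate-cong; toList-∷ʳ; length-toList)
open import Data.Vec.Recursive using (Fin[m^n]↔Fin[m]^n; lift↔)
open import Data.Vec.Recursive.Properties using (↔Vec)
open import Function using (_∘_; const)
open import Function.Consequences.Propositional using (strictlySurjective⇒surjective)
open import Function.Definitions using (Injective; Surjective; StrictlySurjective)
import Function.Properties.Equivalence as ⇔
open import Function.Properties.Inverse using (↔-sym; ↔-trans; ↔⇒↣)
open import Relation.Nullary using (yes; no; contradiction)
open import Relation.Binary.PropositionalEquality hiding ([_])
open ≡-Reasoning

module Xor = CommutativeSemigroupProperties (CommutativeRing.+-commutativeSemigroup xor-∧-commutativeRing)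
module And = CommutativeSemigroupProperties (CommutativeMonoid.commutativeSemigroup ∧-commutativeMonoid)

xor-cancelʳ : ∀ x y k → (x xor k) xor (y xor k) ≡ x xor y
xor-cancelʳ x y k = begin
  (x xor k) xor (y xor k)   ≡⟨ Xor.interchange x k y k ⟩
  (x xor y) xor (k xor k)   ≡⟨ cong ((x xor y) xor_) (xor-same k) ⟩
  (x xor y) xor false       ≡⟨ xor-identityʳ (x xor y) ⟩
  x xor y                   ∎

xor≡false⇒≡ : ∀ x y → x xor y ≡ false → x ≡ y
xor≡false⇒≡ false false _  = refl
xor≡false⇒≡ true  true  _  = refl
xor≡false⇒≡ false true  ()
xor≡false⇒≡ true  false ()

not∧≡true : ∀ g h → not g ∧ h ≡ true → g ≡ false × h ≡ true
not∧≡true false h e = refl , e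

xor-gate≡true : ∀ c x g h → (c ∧ x) xor (not g ∧ h) ≡ true → x ≡ true ⊎ (g ≡ false × h ≡ true)
xor-gate≡true _     true  _ _ _ = inj₁ refl
xor-gate≡true true  false g h e = inj₂ (not∧≡true g h e)
xor-gate≡true false false g h e = inj₂ (not∧≡true g h e)

not-∧-cong : ∀ x y h → (h ≡ true → x ≡ y) → not x ∧ h ≡ not y ∧ h
not-∧-cong x y true  e = cong (λ z → not z ∧ true) (e refl)
not-∧-cong x y false e = trans (∧-zeroʳ (not x)) (sym (∧-zeroʳ (not y)))

-- Periodic sequences

Seq : Set
Seq = ℕ → Bool

Periodic : ℕ → Seq → Set
Periodic N u = ∀ i → u (i + N) ≡ u i

periodic-+* : ∀ {N u} → Periodic N u → ∀ q i → u (i + q * N) ≡ u i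
periodic-+* {N} {u} p zero    i = cong u (+-identityʳ i)
periodic-+* {N} {u} p (suc q) i = begin
  u (i + (N + q * N)) ≡⟨ cong u (solve (i ∷ N ∷ q ∷ [])) ⟩
  u (i + q * N + N)   ≡⟨ p (i + q * N) ⟩
  u (i + q * N)       ≡⟨ periodic-+* p q i ⟩
  u i                 ∎

periodic-% : ∀ {N u} .{{_ : NonZero N}} → Periodic N u → ∀ i → u (i % N) ≡ u i
periodic-% {N} {u} p i = begin
  u (i % N)               ≡⟨ periodic-+* p (i / N) (i % N) ⟨
  u (i % N + i / N * N)   ≡⟨ cong u (m≡m%n+[m/n]*n i N) ⟨
  u i                     ∎

2*n≡n+n : ∀ n → 2 * n ≡ n + n
2*n≡n+n n = cong (n +_) (+-identityʳ n)

sample : Seq → ℕ → Seq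
sample u b k = u (b + 2 * k)

ZeroSample : Seq → ℕ → Set
ZeroSample u b = ∀ k → sample u b k ≡ false

sample-periodic : ∀ {M u} → Periodic (M + M) u → ∀ b → Periodic M (sample u b)
sample-periodic {M} {u} p b k = begin
  u (b + 2 * (k + M))       ≡⟨ cong u (solve (b ∷ k ∷ M ∷ [])) ⟩
  u (b + 2 * k + (M + M))   ≡⟨ p (b + 2 * k) ⟩
  u (b + 2 * k)             ∎

zeroSample-head : ∀ {u b} → ZeroSample u b → u b ≡ false
zeroSample-head {u} {b} z = trans (cong u (sym (+-identityʳ b))) (z 0)

zeroSample-step : ∀ {u b} → ZeroSample u b → ZeroSample u (2 + b)
zeroSample-step {u} {b} z k = begin
  u (2 + b + 2 * k)     ≡⟨ cong u (solve (b ∷ k ∷ [])) ⟩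
  u (b + 2 * suc k)     ≡⟨ z (suc k) ⟩
  false                 ∎

zeroSample-+ : ∀ {u b} → ZeroSample u b → ∀ k → ZeroSample u (b + 2 * k)
zeroSample-+ {u} {b} z k k′ = begin
  u (b + 2 * k + 2 * k′)    ≡⟨ cong u (solve (b ∷ k ∷ k′ ∷ [])) ⟩
  u (b + 2 * (k + k′))      ≡⟨ z (k + k′) ⟩
  false                     ∎

zeroSample-+⁻¹ : ∀ {M u} .{{_ : NonZero M}} → Periodic (M + M) u →
                 ∀ b k → ZeroSample u (b + 2 * k) → ZeroSample u b
zeroSample-+⁻¹ {suc m} {u} p b k z k′ = begin
  u (b + 2 * k′)                          ≡⟨ periodic-+* p k (b + 2 * k′) ⟨
  u (b + 2 * k′ + k * (suc m + suc m))    ≡⟨ cong u (solve (b ∷ k ∷ k′ ∷ m ∷ [])) ⟩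
  u (b + 2 * k + 2 * (k′ + k * m))        ≡⟨ z (k′ + k * m) ⟩
  false                                   ∎

zeroSample-parities : ∀ {w b} → ZeroSample w b → ZeroSample w (suc b) → ∀ i → w (b + i) ≡ false
zeroSample-parities {w} {b} z z′ zero    = trans (cong w (+-identityʳ b)) (zeroSample-head {w} z)
zeroSample-parities {w} {b} z z′ (suc i) = begin
  w (b + suc i)     ≡⟨ cong w (solve (b ∷ i ∷ [])) ⟩
  w (suc b + i)     ≡⟨ zeroSample-parities {w} {suc b} z′ (zeroSample-step {w} {b} z) i ⟩
  false             ∎

-- Horner form of f

-- horner (c₀ ∷ c₁ ∷ …) u j = Σₖ cₖ u(j+2k) ∏_{l<k} (1 + u(j+2l+1)), so that f is
-- horner (true ∷ toList a) on sequences (toSeq-fMap below).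
horner : List Bool → Seq → Seq
horner []       u j = false
horner (c ∷ cs) u j = (c ∧ u j) xor (not (u (suc j)) ∧ horner cs u (2 + j))

carry : List Bool → Seq → Seq
carry cs u j = not (u (suc j)) ∧ horner cs u (2 + j)

horner-cong : ∀ cs {u v} → (∀ i → u i ≡ v i) → ∀ j → horner cs u j ≡ horner cs v j
horner-cong []       e j = refl
horner-cong (c ∷ cs) e j =
  cong₂ (λ x y → (c ∧ x) xor y) (e j)
        (cong₂ (λ x y → not x ∧ y) (e (suc j)) (horner-cong cs e (2 + j)))

horner-periodic : ∀ {N u} → Periodic N u → ∀ cs → Periodic N (horner cs u)
horner-periodic p []       i = refl
horner-periodic p (c ∷ cs) i =
  cong₂ (λ x y → (c ∧ x) xor y) (p i)
        (cong₂ (λ x y → not x ∧ y) (p (suc i)) (horner-periodic p cs (2 + i)))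

horner-zeroSample : ∀ {u b} → ZeroSample u b → ∀ cs → horner cs u b ≡ false
horner-zeroSample         z []       = refl
horner-zeroSample {u} {b} z (c ∷ cs) = begin
  (c ∧ u b) xor (not (u (suc b)) ∧ horner cs u (2 + b))
    ≡⟨ cong₂ (λ x y → (c ∧ x) xor (not (u (suc b)) ∧ y))
             (zeroSample-head {u} z) (horner-zeroSample {u} {2 + b} (zeroSample-step {u} {b} z) cs) ⟩
  (c ∧ false) xor (not (u (suc b)) ∧ false)
    ≡⟨ cong₂ _xor_ (∧-zeroʳ c) (∧-zeroʳ (not (u (suc b)))) ⟩
  false ∎

horner-const-false : ∀ cs i → horner cs (const false) i ≡ false
horner-const-false cs i = horner-zeroSample {const false} {i} (λ _ → refl) cs

zeroSample-horner : ∀ {u b} → ZeroSample u b → ∀ cs → ZeroSample (horner cs u) b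
zeroSample-horner {u} {b} z cs k = horner-zeroSample {u} (zeroSample-+ {u} {b} z k) cs

infixl 6 _⊕_

_⊕_ : List Bool → List Bool → List Bool
[]       ⊕ ds       = ds
(c ∷ cs) ⊕ []       = c ∷ cs
(c ∷ cs) ⊕ (d ∷ ds) = (c xor d) ∷ (cs ⊕ ds)

horner-⊕ : ∀ cs ds u j → horner (cs ⊕ ds) u j ≡ horner cs u j xor horner ds u j
horner-⊕ []       ds       u j = refl
horner-⊕ (c ∷ cs) []       u j = sym (xor-identityʳ _)
horner-⊕ (c ∷ cs) (d ∷ ds) u j = begin
  ((c xor d) ∧ x) xor (g ∧ horner (cs ⊕ ds) u (2 + j))
    ≡⟨ cong₂ _xor_ (∧-distribʳ-xor x c d)
                   (trans (cong (g ∧_) (horner-⊕ cs ds u (2 + j))) (∧-distribˡ-xor g _ _)) ⟩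
  ((c ∧ x) xor (d ∧ x)) xor ((g ∧ horner cs u (2 + j)) xor (g ∧ horner ds u (2 + j)))
    ≡⟨ Xor.interchange (c ∧ x) (d ∧ x) (g ∧ horner cs u (2 + j)) (g ∧ horner ds u (2 + j)) ⟩
  ((c ∧ x) xor (g ∧ horner cs u (2 + j))) xor ((d ∧ x) xor (g ∧ horner ds u (2 + j)))
    ∎
  where
  x = u j
  g = not (u (suc j))

carry-⊕ : ∀ cs ds u j → carry (cs ⊕ ds) u j ≡ carry cs u j xor carry ds u j
carry-⊕ cs ds u j =
  trans (cong (not (u (suc j)) ∧_) (horner-⊕ cs ds u (2 + j)))
        (∧-distribˡ-xor (not (u (suc j))) (horner cs u (2 + j)) (horner ds u (2 + j)))

-- Local inversion

data CutWithin (u : Seq) : ℕ → ℕ → Set where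
  here  : ∀ {j R} → u (suc j) ≡ true → CutWithin u j (suc R)
  there : ∀ {j R} → CutWithin u (2 + j) R → CutWithin u j (suc R)

cutWithin-cong : ∀ {u v} → (∀ i → u i ≡ v i) → ∀ {j R} → CutWithin u j R → CutWithin v j R
cutWithin-cong e (here u≡true) = here (trans (sym (e _)) u≡true)
cutWithin-cong e (there cut)   = there (cutWithin-cong e cut)

cutWithin? : ∀ u j R → CutWithin u j R ⊎ (∀ l → l < R → u (suc j + 2 * l) ≡ false)
cutWithin? u j zero = inj₂ λ _ ()
cutWithin? u j (suc R) with u (suc j) in e | cutWithin? u (2 + j) R
... | true  | _        = inj₁ (here e)
... | false | inj₁ cut = inj₁ (there cut)
... | false | inj₂ z   = inj₂ λ where
  zero    _         → trans (cong u (+-identityʳ (suc j))) e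
  (suc l) (s≤s l<R) → begin
    u (suc j + 2 * suc l)       ≡⟨ cong u (solve (j ∷ l ∷ [])) ⟩
    u (suc (2 + j) + 2 * l)     ≡⟨ z l l<R ⟩
    false                       ∎

cutWithin-or-zeroSample : ∀ {M u} .{{_ : NonZero M}} → Periodic (M + M) u →
                          ∀ j → CutWithin u j M ⊎ ZeroSample u (suc j)
cutWithin-or-zeroSample {M} {u} p j with cutWithin? u j M
... | inj₁ cut = inj₁ cut
... | inj₂ z   = inj₂ λ k →
  trans (sym (periodic-% (sample-periodic p (suc j)) k)) (z (k % M) (m%n<n k M))

cutWithin-zeroSample-⊥ : ∀ {u j R} → CutWithin u j R → ZeroSample u (suc j) → ⊥
cutWithin-zeroSample-⊥ {u} (here u≡true) z = contradiction (trans (sym u≡true) (zeroSample-head {u} z)) λ ()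
cutWithin-zeroSample-⊥ {u} {j} (there cut) z = cutWithin-zeroSample-⊥ cut (zeroSample-step {u} {suc j} z)

cutWithin-horner : ∀ {M u} .{{_ : NonZero M}} → Periodic (M + M) u →
                   ∀ cs {j} → CutWithin (horner cs u) j M → CutWithin u j M
cutWithin-horner {u = u} p cs {j} cut with cutWithin-or-zeroSample p j
... | inj₁ cut′ = cut′
... | inj₂ z    = ⊥-elim (cutWithin-zeroSample-⊥ cut (zeroSample-horner {u} {suc j} z cs))

cut-gate : ∀ {u j R x y} → CutWithin u j (suc R) → (CutWithin u (2 + j) R → x ≡ y) →
           not (u (suc j)) ∧ x ≡ not (u (suc j)) ∧ y
cut-gate {x = x} {y} (here u≡true) _ =
  trans (cong (λ b → not b ∧ x) u≡true) (sym (cong (λ b → not b ∧ y) u≡true))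
cut-gate {u} {j} (there cut) e = cong (not (u (suc j)) ∧_) (e cut)

data NoCarry (u : Seq) : ℕ → Set where
  here  : ∀ {i} → u (suc i) ≡ true → NoCarry u i
  there : ∀ {i} → u (2 + i) ≡ false → NoCarry u (2 + i) → NoCarry u i

noCarry⇒carry≡false : ∀ {u i} → NoCarry u i → ∀ cs → carry cs u i ≡ false
noCarry⇒carry≡false {u} (here u≡true) cs = cong (λ x → not x ∧ horner cs u _) u≡true
noCarry⇒carry≡false {u} {i} (there u≡false d) cs =
  trans (cong (not (u (suc i)) ∧_) (horner≡false cs)) (∧-zeroʳ _)
  where
  horner≡false : ∀ cs → horner cs u (2 + i) ≡ false
  horner≡false []       = refl
  horner≡false (c ∷ cs) = trans (cong₂ (λ x y → (c ∧ x) xor y) u≡false (noCarry⇒carry≡false d cs))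
                                (cong (_xor false) (∧-zeroʳ c))

horner≡true⇒noCarry : ∀ {u} cs i → horner cs u (suc i) ≡ true → NoCarry u i
horner≡true⇒noCarry {u} (c ∷ cs) i h with xor-gate≡true c (u (suc i)) (u (2 + i)) (horner cs u (3 + i)) h
... | inj₁ u≡true         = here u≡true
... | inj₂ (u≡false , h′) = there u≡false (horner≡true⇒noCarry cs (2 + i) h′)

module _ (ps : List Bool) where

  noCarry⇒horner≡ : ∀ {u j} → NoCarry u j → horner (true ∷ ps) u j ≡ u j
  noCarry⇒horner≡ {u} {j} d = trans (cong (u j xor_) (noCarry⇒carry≡false d ps)) (xor-identityʳ (u j))

  horner∘horner≡true⇒noCarry : ∀ {u} qs j →
    horner qs (horner (true ∷ ps) u) (suc j) ≡ true → NoCarry u j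
  horner∘horner≡true⇒noCarry {u} (q ∷ qs) j h
    with xor-gate≡true q (horner (true ∷ ps) u (suc j)) (horner (true ∷ ps) u (2 + j))
                         (horner qs (horner (true ∷ ps) u) (3 + j)) h
  ... | inj₁ w≡true         = horner≡true⇒noCarry (true ∷ ps) j w≡true
  ... | inj₂ (w≡false , h′) = there (trans (sym (noCarry⇒horner≡ d)) w≡false) d
    where d = horner∘horner≡true⇒noCarry qs (2 + j) h′

  carry-horner : ∀ {u} cs j →
    carry cs (horner (true ∷ ps) u) j ≡ not (u (suc j)) ∧ horner cs (horner (true ∷ ps) u) (2 + j)
  carry-horner {u} cs j =
    not-∧-cong (horner (true ∷ ps) u (suc j)) (u (suc j)) (horner cs (horner (true ∷ ps) u) (2 + j))
               (λ h → noCarry⇒horner≡ (horner∘horner≡true⇒noCarry {u} cs (suc j) h))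

  -- horner (true ∷ ps) u (2 + j) is u (2 + j) plus carry ps u (2 + j), so a coefficient true
  -- in front is compensated by aiming the remaining coefficients at cs ⊕ ps.
  carry-inverse : ∀ R cs → ∃[ qs ] ∀ {u j} → CutWithin u j R →
                  carry qs (horner (true ∷ ps) u) j ≡ carry cs u j
  carry-inverse zero    cs           = [] , λ ()
  carry-inverse (suc R) []           = [] , λ _ → trans (∧-zeroʳ _) (sym (∧-zeroʳ _))
  carry-inverse (suc R) (false ∷ cs) = false ∷ qs , λ {u} {j} cut →
    trans (carry-horner {u} (false ∷ qs) j) (cut-gate cut (proj₂ (carry-inverse R cs)))
    where qs = proj₁ (carry-inverse R cs)
  carry-inverse (suc R) (true ∷ cs)  = true ∷ qs , λ {u} {j} cut →
    trans (carry-horner {u} (true ∷ qs) j) (cut-gate cut (step u j))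
    where
    qs = proj₁ (carry-inverse R (cs ⊕ ps))
    step : ∀ u j → CutWithin u (2 + j) R →
           horner (true ∷ qs) (horner (true ∷ ps) u) (2 + j) ≡ horner (true ∷ cs) u (2 + j)
    step u j cut = begin
      (u (2 + j) xor carry ps u (2 + j)) xor carry qs (horner (true ∷ ps) u) (2 + j)
        ≡⟨ cong ((u (2 + j) xor carry ps u (2 + j)) xor_)
                (trans (proj₂ (carry-inverse R (cs ⊕ ps)) cut) (carry-⊕ cs ps u (2 + j))) ⟩
      (u (2 + j) xor carry ps u (2 + j)) xor (carry cs u (2 + j) xor carry ps u (2 + j))
        ≡⟨ xor-cancelʳ (u (2 + j)) (carry cs u (2 + j)) (carry ps u (2 + j)) ⟩
      u (2 + j) xor carry cs u (2 + j)
        ∎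

  horner-inverse : ∀ R → ∃[ qs ] ∀ {u j} → CutWithin u j R → horner qs (horner (true ∷ ps) u) j ≡ u j
  horner-inverse R = true ∷ qs , λ {u} {j} cut → begin
    horner (true ∷ ps) u j xor carry qs (horner (true ∷ ps) u) j
      ≡⟨ cong (horner (true ∷ ps) u j xor_) (proj₂ (carry-inverse R ps) cut) ⟩
    (u j xor carry ps u j) xor (false xor carry ps u j)
      ≡⟨ xor-cancelʳ (u j) false (carry ps u j) ⟩
    u j xor false
      ≡⟨ xor-identityʳ (u j) ⟩
    u j ∎
    where qs = proj₁ (carry-inverse R ps)

-- The linear part

linear : List Bool → Seq → Seq
linear []       s i = false
linear (c ∷ cs) s i = (c ∧ s i) xor linear cs s (suc i)

-- Equivalently, Σ cₖ Xᵏ is coprime to X^M − 1 over F₂.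
TrivialKernel : List Bool → ℕ → Set
TrivialKernel cs M = ∀ s → Periodic M s → (∀ i → linear cs s i ≡ false) → ∀ i → s i ≡ false

linear-cong : ∀ cs {s t} → (∀ i → s i ≡ t i) → ∀ i → linear cs s i ≡ linear cs t i
linear-cong []       e i = refl
linear-cong (c ∷ cs) e i = cong₂ (λ x y → (c ∧ x) xor y) (e i) (linear-cong cs e (suc i))

linear-xor : ∀ cs s t i → linear cs (λ k → s k xor t k) i ≡ linear cs s i xor linear cs t i
linear-xor []       s t i = refl
linear-xor (c ∷ cs) s t i = begin
  (c ∧ (s i xor t i)) xor linear cs (λ k → s k xor t k) (suc i)
    ≡⟨ cong₂ _xor_ (∧-distribˡ-xor c (s i) (t i)) (linear-xor cs s t (suc i)) ⟩
  ((c ∧ s i) xor (c ∧ t i)) xor (linear cs s (suc i) xor linear cs t (suc i))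
    ≡⟨ Xor.interchange (c ∧ s i) (c ∧ t i) (linear cs s (suc i)) (linear cs t (suc i)) ⟩
  ((c ∧ s i) xor linear cs s (suc i)) xor ((c ∧ t i) xor linear cs t (suc i))
    ∎

linear-shift : ∀ cs s M i → linear cs (λ k → s (k + M)) i ≡ linear cs s (i + M)
linear-shift []       s M i = refl
linear-shift (c ∷ cs) s M i = cong ((c ∧ s (i + M)) xor_) (linear-shift cs s M (suc i))

trivialKernel⇒injective : ∀ {cs M} → TrivialKernel cs M → ∀ {s t} → Periodic M s → Periodic M t →
                          (∀ i → linear cs s i ≡ linear cs t i) → ∀ i → s i ≡ t i
trivialKernel⇒injective {cs} K {s} {t} ps pt e i =
  xor≡false⇒≡ (s i) (t i) (K (λ k → s k xor t k) (λ k → cong₂ _xor_ (ps k) (pt k)) kernel i)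
  where
  kernel : ∀ k → linear cs (λ k → s k xor t k) k ≡ false
  kernel k = begin
    linear cs (λ k → s k xor t k) k      ≡⟨ linear-xor cs s t k ⟩
    linear cs s k xor linear cs t k      ≡⟨ cong (_xor linear cs t k) (e k) ⟩
    linear cs t k xor linear cs t k      ≡⟨ xor-same (linear cs t k) ⟩
    false                                ∎

sample-horner : ∀ {u b} → ZeroSample u (suc b) →
                ∀ cs k → horner cs u (b + 2 * k) ≡ linear cs (sample u b) k
sample-horner         z []       k = refl
sample-horner {u} {b} z (c ∷ cs) k =
  cong₂ (λ x y → (c ∧ u (b + 2 * k)) xor (not x ∧ y)) (z k) (begin
    horner cs u (2 + (b + 2 * k))   ≡⟨ cong (horner cs u) (solve (b ∷ k ∷ [])) ⟩
    horner cs u (b + 2 * suc k)     ≡⟨ sample-horner {u} z cs (suc k) ⟩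
    linear cs (sample u b) (suc k)  ∎)

horner-sample-injective : ∀ {cs M u v b} → TrivialKernel cs M →
  Periodic (M + M) u → Periodic (M + M) v → ZeroSample u (suc b) → ZeroSample v (suc b) →
  (∀ k → horner cs u (b + 2 * k) ≡ horner cs v (b + 2 * k)) → ∀ k → sample u b k ≡ sample v b k
horner-sample-injective {cs} {M} {u} {v} {b} K pu pv zu zv e =
  trivialKernel⇒injective {cs} {M} K {sample u b} {sample v b}
    (sample-periodic pu b) (sample-periodic pv b) λ k → begin
    linear cs (sample u b) k    ≡⟨ sample-horner {u} {b} zu cs k ⟨
    horner cs u (b + 2 * k)     ≡⟨ e k ⟩
    horner cs v (b + 2 * k)     ≡⟨ sample-horner {v} {b} zv cs k ⟩
    linear cs (sample v b) k    ∎

module _ (ps : List Bool) {M : ℕ} .{{_ : NonZero M}} (K : TrivialKernel (true ∷ ps) M) where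

  private
    qs = proj₁ (horner-inverse ps M)
    inverse = proj₂ (horner-inverse ps M)

  zeroSample-horner⁻¹ : ∀ {u j} → Periodic (M + M) u →
                        ZeroSample (horner (true ∷ ps) u) (suc j) → ZeroSample u (suc j)
  zeroSample-horner⁻¹ {u} {j} p z k
    with cutWithin-or-zeroSample p (suc j) | cutWithin-or-zeroSample p (suc j + 2 * k)
  ... | inj₂ z′  | _         =
    horner-sample-injective {true ∷ ps} {M} {u} {const false} {suc j} K p (λ _ → refl) z′ (λ _ → refl)
      (λ k → trans (z k) (sym (horner-const-false (true ∷ ps) (suc j + 2 * k)))) k
  ... | inj₁ cut | inj₁ cut′ =
    trans (sym (inverse cut′)) (zeroSample-horner {horner (true ∷ ps) u} {suc j} z qs k)
  ... | inj₁ cut | inj₂ z″   = ⊥-elim (cutWithin-zeroSample-⊥ cut (zeroSample-+⁻¹ p (2 + j) k z″))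

  horner-injective : ∀ {u v} → Periodic (M + M) u → Periodic (M + M) v →
                     (∀ i → horner (true ∷ ps) u i ≡ horner (true ∷ ps) v i) → ∀ j → u j ≡ v j
  horner-injective {u} {v} pu pv e j with cutWithin-or-zeroSample (horner-periodic pu (true ∷ ps)) j
  ... | inj₁ cut = begin
    u j                                ≡⟨ inverse (cutWithin-horner pu (true ∷ ps) cut) ⟨
    horner qs (horner (true ∷ ps) u) j ≡⟨ horner-cong qs e j ⟩
    horner qs (horner (true ∷ ps) v) j ≡⟨ inverse (cutWithin-horner pv (true ∷ ps) (cutWithin-cong e cut)) ⟩
    v j                                ∎
  ... | inj₂ z = begin
    u j            ≡⟨ cong u (+-identityʳ j) ⟨
    sample u j 0   ≡⟨ same-sample 0 ⟩
    sample v j 0   ≡⟨ cong v (+-identityʳ j) ⟩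
    v j            ∎
    where
    zu = zeroSample-horner⁻¹ {u} {j} pu z
    zv = zeroSample-horner⁻¹ {v} {j} pv (λ k → trans (sym (e _)) (z k))
    same-sample = horner-sample-injective {true ∷ ps} {M} {u} {v} {j} K pu pv zu zv (λ k → e (j + 2 * k))

-- Vectors as periodic sequences

-- Chosen so that shiftAt x k j is toSeq x (toℕ j + k) by definition.
toSeq : ∀ {n} → Vec Bool (suc n) → Seq
toSeq {n} x i = lookup x (fromℕ< (m%n<n i (suc n)))

toSeq-toℕ : ∀ {n} (x : Vec Bool (suc n)) j → toSeq x (toℕ j) ≡ lookup x j
toSeq-toℕ x j = cong (lookup x) (toℕ-injective (trans (toℕ-fromℕ< _) (m<n⇒m%n≡m (toℕ<n j))))

toSeq-periodic : ∀ {n} (x : Vec Bool (suc n)) → Periodic (suc n) (toSeq x)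
toSeq-periodic {n} x i = cong (lookup x) (fromℕ<-cong _ _ ([m+n]%n≡m%n i (suc n)) _ _)

toSeq-injective : ∀ {n} {x y : Vec Bool (suc n)} → (∀ i → toSeq x i ≡ toSeq y i) → x ≡ y
toSeq-injective {x = x} {y} e = begin
  x                     ≡⟨ tabulate∘lookup x ⟨
  tabulate (lookup x)   ≡⟨ tabulate-cong (λ j → trans (sym (toSeq-toℕ x j))
                                                     (trans (e (toℕ j)) (toSeq-toℕ y j))) ⟩
  tabulate (lookup y)   ≡⟨ tabulate∘lookup y ⟩
  y                     ∎

fromSeq : ∀ {n} → Seq → Vec Bool n
fromSeq u = tabulate (u ∘ toℕ)

toSeq-fromSeq : ∀ {n u} → Periodic (suc n) u → ∀ i → toSeq (fromSeq {suc n} u) i ≡ u i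
toSeq-fromSeq {n} {u} p i = begin
  lookup (fromSeq u) (fromℕ< (m%n<n i (suc n)))   ≡⟨ lookup∘tabulate (u ∘ toℕ) _ ⟩
  u (toℕ (fromℕ< (m%n<n i (suc n))))             ≡⟨ cong u (toℕ-fromℕ< _) ⟩
  u (i % suc n)                                   ≡⟨ periodic-% p i ⟩
  u i                                             ∎

oddProdₛ : Seq → ℕ → Seq
oddProdₛ u zero    j = true
oddProdₛ u (suc k) j = not (u (j + (k + k + 1))) ∧ oddProdₛ u k j

γₛ : ℕ → Seq → Seq
γₛ k u j = u (j + (k + k)) ∧ oddProdₛ u k j

lookup-γ : ∀ {n} k (x : Vec Bool (suc n)) j → lookup (γ k x) j ≡ γₛ k (toSeq x) (toℕ j)
lookup-γ k x j = trans (lookup∘tabulate (λ j → shiftAt x (k + k) j ∧ oddProd x k j) j)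
                       (cong (toSeq x (toℕ j + (k + k)) ∧_) (oddProd≡oddProdₛ k))
  where
  oddProd≡oddProdₛ : ∀ k → oddProd x k j ≡ oddProdₛ (toSeq x) k (toℕ j)
  oddProd≡oddProdₛ zero    = refl
  oddProd≡oddProdₛ (suc k) = cong (not (toSeq x (toℕ j + (k + k + 1))) ∧_) (oddProd≡oddProdₛ k)

oddProdₛ-suc : ∀ u k j → oddProdₛ u (suc k) j ≡ not (u (suc j)) ∧ oddProdₛ u k (2 + j)
oddProdₛ-suc u zero    j = cong (λ i → not (u i) ∧ true) (solve (j ∷ []))
oddProdₛ-suc u (suc k) j = begin
  not (u (j + (suc k + suc k + 1))) ∧ oddProdₛ u (suc k) j
    ≡⟨ cong₂ (λ i g → not (u i) ∧ g) (solve (j ∷ k ∷ [])) (oddProdₛ-suc u k j) ⟩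
  not (u (2 + j + (k + k + 1))) ∧ (not (u (suc j)) ∧ oddProdₛ u k (2 + j))
    ≡⟨ And.x∙yz≈y∙xz (not (u (2 + j + (k + k + 1)))) (not (u (suc j))) (oddProdₛ u k (2 + j)) ⟩
  not (u (suc j)) ∧ oddProdₛ u (suc k) (2 + j)
    ∎

γₛ-suc : ∀ k u j → γₛ (suc k) u j ≡ not (u (suc j)) ∧ γₛ k u (2 + j)
γₛ-suc k u j = begin
  u (j + (suc k + suc k)) ∧ oddProdₛ u (suc k) j
    ≡⟨ cong₂ (λ i g → u i ∧ g) (solve (j ∷ k ∷ [])) (oddProdₛ-suc u k j) ⟩
  u (2 + j + (k + k)) ∧ (not (u (suc j)) ∧ oddProdₛ u k (2 + j))
    ≡⟨ And.x∙yz≈y∙xz (u (2 + j + (k + k))) (not (u (suc j))) (oddProdₛ u k (2 + j)) ⟩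
  not (u (suc j)) ∧ γₛ k u (2 + j)
    ∎

horner-∷ʳ : ∀ cs c u j → horner (cs ++ [ c ]) u j ≡ horner cs u j xor (c ∧ γₛ (length cs) u j)
horner-∷ʳ []       c u j = begin
  (c ∧ u j) xor (not (u (suc j)) ∧ false)
    ≡⟨ cong₂ _xor_ (cong (c ∧_) (sym (trans (∧-identityʳ _) (cong u (+-identityʳ j))))) (∧-zeroʳ _) ⟩
  (c ∧ γₛ 0 u j) xor false
    ≡⟨ xor-identityʳ _ ⟩
  c ∧ γₛ 0 u j
    ∎
horner-∷ʳ (d ∷ cs) c u j = begin
  (d ∧ u j) xor (g ∧ horner (cs ++ [ c ]) u (2 + j))
    ≡⟨ cong (λ h → (d ∧ u j) xor (g ∧ h)) (horner-∷ʳ cs c u (2 + j)) ⟩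
  (d ∧ u j) xor (g ∧ (horner cs u (2 + j) xor (c ∧ γₛ n u (2 + j))))
    ≡⟨ cong ((d ∧ u j) xor_) (∧-distribˡ-xor g (horner cs u (2 + j)) (c ∧ γₛ n u (2 + j))) ⟩
  (d ∧ u j) xor ((g ∧ horner cs u (2 + j)) xor (g ∧ (c ∧ γₛ n u (2 + j))))
    ≡⟨ xor-assoc (d ∧ u j) (g ∧ horner cs u (2 + j)) (g ∧ (c ∧ γₛ n u (2 + j))) ⟨
  horner (d ∷ cs) u j xor (g ∧ (c ∧ γₛ n u (2 + j)))
    ≡⟨ cong (horner (d ∷ cs) u j xor_)
            (trans (And.x∙yz≈y∙xz g c (γₛ n u (2 + j))) (cong (c ∧_) (sym (γₛ-suc n u j)))) ⟩
  horner (d ∷ cs) u j xor (c ∧ γₛ (suc n) u j)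
    ∎
  where
  g = not (u (suc j))
  n = length cs

toList-init-last : ∀ {t} (a : Vec Bool (suc t)) → toList (init a) ++ [ last a ] ≡ toList a
toList-init-last a =
  trans (sym (toList-∷ʳ (last a) (init a))) (cong toList (sym (proj₂ (proj₂ (initLast a)))))

horner-sumγ : ∀ {n} t (a : Vec Bool t) (x : Vec Bool (suc n)) j →
              toSeq x (toℕ j) xor sumγ t a x j ≡ horner (true ∷ toList a) (toSeq x) (toℕ j)
horner-sumγ zero    [] x j = cong (toSeq x (toℕ j) xor_) (sym (∧-zeroʳ _))
horner-sumγ (suc t) a  x j = begin
  u i xor (sumγ t (init a) x j xor (last a ∧ lookup (γ (suc t) x) j))
    ≡⟨ xor-assoc (u i) (sumγ t (init a) x j) (last a ∧ lookup (γ (suc t) x) j) ⟨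
  (u i xor sumγ t (init a) x j) xor (last a ∧ lookup (γ (suc t) x) j)
    ≡⟨ cong₂ (λ h g → h xor (last a ∧ g)) (horner-sumγ t (init a) x j) (lookup-γ (suc t) x j) ⟩
  horner cs u i xor (last a ∧ γₛ (suc t) u i)
    ≡⟨ cong (λ n → horner cs u i xor (last a ∧ γₛ (suc n) u i)) (length-toList (init a)) ⟨
  horner cs u i xor (last a ∧ γₛ (length cs) u i)
    ≡⟨ horner-∷ʳ cs (last a) u i ⟨
  horner (cs ++ [ last a ]) u i
    ≡⟨ cong (λ cs → horner (true ∷ cs) u i) (toList-init-last a) ⟩
  horner (true ∷ toList a) u i
    ∎
  where
  u = toSeq x
  i = toℕ j
  cs = true ∷ toList (init a)

toSeq-fMap : ∀ {n} t (a : Vec Bool t) (x : Vec Bool (suc n)) i →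
             toSeq (fMap t a x) i ≡ horner (true ∷ toList a) (toSeq x) i
toSeq-fMap {n} t a x i = begin
  lookup (fMap t a x) j              ≡⟨ lookup∘tabulate (λ j → lookup x j xor sumγ t a x j) j ⟩
  lookup x j xor sumγ t a x j        ≡⟨ cong (_xor sumγ t a x j) (toSeq-toℕ x j) ⟨
  toSeq x (toℕ j) xor sumγ t a x j   ≡⟨ horner-sumγ t a x j ⟩
  horner P (toSeq x) (toℕ j)         ≡⟨ cong (horner P (toSeq x)) (toℕ-fromℕ< _) ⟩
  horner P (toSeq x) (i % suc n)     ≡⟨ periodic-% (horner-periodic (toSeq-periodic x) P) i ⟩
  horner P (toSeq x) i               ∎
  where
  j = fromℕ< (m%n<n i (suc n))
  P = true ∷ toList a

Fin-injective⇒surjective : ∀ {k} (g : Fin k → Fin k) → Injective _≡_ _≡_ g → StrictlySurjective _≡_ g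
Fin-injective⇒surjective {suc k} g injective y with any? (λ i → g i ≟ y)
... | yes hit  = hit
... | no  miss = contradiction (injective⇒≤ punchOut∘g-injective) (n≮n k)
  where
  y≢g : ∀ i → y ≢ g i
  y≢g i y≡gi = miss (i , sym y≡gi)
  punchOut∘g : Fin (suc k) → Fin k
  punchOut∘g i = punchOut (y≢g i)
  punchOut∘g-injective : Injective _≡_ _≡_ punchOut∘g
  punchOut∘g-injective {i} {j} eq = injective (punchOut-injective (y≢g i) (y≢g j) eq)

↔Fin-injective⇒surjective : ∀ {A : Set} {k} → A ↔ Fin k →
                            (f : A → A) → Injective _≡_ _≡_ f → Surjective _≡_ _≡_ f
↔Fin-injective⇒surjective A↔Fin f injective = strictlySurjective⇒surjective λ y →
  let i , gi≡y = Fin-injective⇒surjective (to ∘ f ∘ from) g-injective (to y) in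
  from i , (begin
    f (from i)              ≡⟨ strictlyInverseʳ (f (from i)) ⟨
    from (to (f (from i)))  ≡⟨ cong from gi≡y ⟩
    from (to y)             ≡⟨ strictlyInverseʳ y ⟩
    y                       ∎)
  where
  open Inverse A↔Fin
  g-injective : Injective _≡_ _≡_ (to ∘ f ∘ from)
  g-injective {i} {j} eq = begin
    i              ≡⟨ strictlyInverseˡ i ⟨
    to (from i)    ≡⟨ cong to (injective (Injection.injective (↔⇒↣ A↔Fin) eq)) ⟩
    to (from j)    ≡⟨ strictlyInverseˡ j ⟩
    j              ∎

Vec-Bool↔Fin : ∀ n → Vec Bool n ↔ Fin (2 ^ n)
Vec-Bool↔Fin n = ↔-sym (↔-trans (Fin[m^n]↔Fin[m]^n 2 n) (↔-trans (lift↔ n 2↔Bool) (↔Vec n)))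

spread : Seq → Seq
spread s zero          = s zero
spread s (suc zero)    = false
spread s (suc (suc i)) = spread (s ∘ suc) i

spread-even : ∀ s k → spread s (2 * k) ≡ s k
spread-even s zero    = refl
spread-even s (suc k) = trans (cong (spread s) (*-suc 2 k)) (spread-even (s ∘ suc) k)

zeroSample-spread : ∀ s → ZeroSample (spread s) 1
zeroSample-spread s zero    = refl
zeroSample-spread s (suc k) = trans (cong (spread s ∘ suc) (*-suc 2 k)) (zeroSample-spread (s ∘ suc) k)

spread-periodic : ∀ {M s} → Periodic M s → Periodic (M + M) (spread s)
spread-periodic {M} {s} p zero          = begin
  spread s (M + M)   ≡⟨ cong (spread s) (2*n≡n+n M) ⟨
  spread s (2 * M)   ≡⟨ spread-even s M ⟩
  s M                ≡⟨ p 0 ⟩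
  s 0                ∎
spread-periodic {M} {s} p (suc zero)    = begin
  spread s (1 + (M + M))   ≡⟨ cong (spread s ∘ suc) (2*n≡n+n M) ⟨
  spread s (1 + 2 * M)     ≡⟨ zeroSample-spread s M ⟩
  false                    ∎
spread-periodic         p (suc (suc i)) = spread-periodic (p ∘ suc) i

horner-spread : ∀ cs s → (∀ k → linear cs s k ≡ false) → ∀ i → horner cs (spread s) i ≡ false
horner-spread cs s kernel = zeroSample-parities {horner cs (spread s)} {0} even odd
  where
  even : ZeroSample (horner cs (spread s)) 0
  even k = begin
    horner cs (spread s) (2 * k)         ≡⟨ sample-horner {spread s} {0} (zeroSample-spread s) cs k ⟩
    linear cs (sample (spread s) 0) k    ≡⟨ linear-cong cs (spread-even s) k ⟩
    linear cs s k                        ≡⟨ kernel k ⟩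
    false                                ∎
  odd : ZeroSample (horner cs (spread s)) 1
  odd = zeroSample-horner {spread s} {1} (zeroSample-spread s) cs

isPermutation⇔trivialKernel : ∀ t (a : Vec Bool t) M .{{_ : NonZero M}} →
  IsPermutation {M + M} (fMap t a) ⇔ TrivialKernel (true ∷ toList a) M
isPermutation⇔trivialKernel t a M@(suc _) = mk⇔ isPermutation⇒trivialKernel trivialKernel⇒isPermutation
  where
  P = true ∷ toList a

  toSeq-fMap-fromSeq : ∀ {u} → Periodic (M + M) u →
                       ∀ i → toSeq (fMap t a (fromSeq {M + M} u)) i ≡ horner P u i
  toSeq-fMap-fromSeq {u} p i = trans (toSeq-fMap t a (fromSeq u) i) (horner-cong P (toSeq-fromSeq p) i)

  isPermutation⇒trivialKernel : IsPermutation (fMap t a) → TrivialKernel P M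
  isPermutation⇒trivialKernel (injective , _) s p kernel k = begin
    s k                ≡⟨ spread-even s k ⟨
    spread s (2 * k)   ≡⟨ toSeq-fromSeq (spread-periodic p) (2 * k) ⟨
    toSeq x (2 * k)    ≡⟨ cong (λ x → toSeq x (2 * k)) (injective {x} {0ⱽ} f[x]≡f[0]) ⟩
    toSeq 0ⱽ (2 * k)   ≡⟨ toSeq-fromSeq {u = const false} (λ _ → refl) (2 * k) ⟩
    false              ∎
    where
    x 0ⱽ : Vec Bool (M + M)
    x  = fromSeq (spread s)
    0ⱽ = fromSeq (const false)
    f[x]≡f[0] : fMap t a x ≡ fMap t a 0ⱽ
    f[x]≡f[0] = toSeq-injective λ i → begin
      toSeq (fMap t a x) i       ≡⟨ toSeq-fMap-fromSeq (spread-periodic p) i ⟩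
      horner P (spread s) i      ≡⟨ horner-spread P s kernel i ⟩
      false                      ≡⟨ horner-const-false P i ⟨
      horner P (const false) i   ≡⟨ toSeq-fMap-fromSeq {const false} (λ _ → refl) i ⟨
      toSeq (fMap t a 0ⱽ) i      ∎

  trivialKernel⇒isPermutation : TrivialKernel P M → IsPermutation (fMap t a)
  trivialKernel⇒isPermutation K = injective , ↔Fin-injective⇒surjective (Vec-Bool↔Fin _) (fMap t a) injective
    where
    injective : Injective _≡_ _≡_ (fMap t a)
    injective {x} {y} f[x]≡f[y] =
      toSeq-injective (horner-injective (toList a) K (toSeq-periodic x) (toSeq-periodic y) λ i → begin
        horner P (toSeq x) i   ≡⟨ toSeq-fMap t a x i ⟨
        toSeq (fMap t a x) i   ≡⟨ cong (λ z → toSeq z i) f[x]≡f[y] ⟩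
        toSeq (fMap t a y) i   ≡⟨ toSeq-fMap t a y i ⟩
        horner P (toSeq y) i   ∎)

-- Doubling the period

trivialKernel-double : ∀ cs M → TrivialKernel cs M ⇔ TrivialKernel cs (M + M)
trivialKernel-double cs M = mk⇔ double halve
  where
  halve : TrivialKernel cs (M + M) → TrivialKernel cs M
  halve K s p = K s λ i → trans (cong s (sym (+-assoc i M M))) (trans (p (i + M)) (p i))

  double : TrivialKernel cs M → TrivialKernel cs (M + M)
  double K s p kernel = K s (λ i → sym (xor≡false⇒≡ (s i) (s (i + M)) (K d d-periodic d-kernel i))) kernel
    where
    d : Seq
    d i = s i xor s (i + M)
    d-periodic : Periodic M d
    d-periodic i =
      trans (cong (s (i + M) xor_) (trans (cong s (+-assoc i M M)) (p i))) (xor-comm (s (i + M)) (s i))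
    d-kernel : ∀ i → linear cs d i ≡ false
    d-kernel i = begin
      linear cs d i
        ≡⟨ linear-xor cs s (λ k → s (k + M)) i ⟩
      linear cs s i xor linear cs (λ k → s (k + M)) i
        ≡⟨ cong₂ _xor_ (kernel i) (trans (linear-shift cs s M i) (kernel (i + M))) ⟩
      false
        ∎

2^[1+k]*n≡2^k*n+2^k*n : ∀ k n → 2 ^ suc k * n ≡ 2 ^ k * n + 2 ^ k * n
2^[1+k]*n≡2^k*n+2^k*n k n = trans (*-assoc 2 (2 ^ k) n) (2*n≡n+n (2 ^ k * n))

trivialKernel-^* : ∀ cs M k → TrivialKernel cs M ⇔ TrivialKernel cs (2 ^ k * M)
trivialKernel-^* cs M zero    rewrite *-identityˡ M = ⇔.refl
trivialKernel-^* cs M (suc k) rewrite 2^[1+k]*n≡2^k*n+2^k*n k M =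
  ⇔.trans (trivialKernel-^* cs M k) (trivialKernel-double cs (2 ^ k * M))

corollary15 : (s m : ℕ) → 2 ≤ s → 1 ≤ m → 2 ∤ m →
    (t : ℕ) → (a : Vec Bool t) →
    IsPermutation {2 ^ s * m} (fMap t a) ⇔ IsPermutation {2 * m} (fMap t a)
corollary15 zero    _ () _   _ _ _
corollary15 (suc s) m _  1≤m _ t a rewrite 2^[1+k]*n≡2^k*n+2^k*n s m | 2*n≡n+n m =
  ⇔.trans (isPermutation⇔trivialKernel t a (2 ^ s * m))
  (⇔.trans (⇔.sym (trivialKernel-^* (true ∷ toList a) m s))
           (⇔.sym (isPermutation⇔trivialKernel t a m)))
  where
  instance
    m≢0 : NonZero m
    m≢0 = >-nonZero 1≤m
    2^s*m≢0 : NonZero (2 ^ s * m)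
    2^s*m≢0 = m*n≢0 (2 ^ s) m {{m^n≢0 2 s}}
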